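{- For all $m,k\in\mathbb{N}_0$ with $m\ne k$ we have $\mathrm{whd}(\mathrm{OFPHP}^m_k)=\mathrm{hd}(\mathrm{OFPHP}^m_k)=\min(m,k)$.
   Context: Literals are variables $v$ or negations $\overline{v}$; clauses finite sets of literals without complementary pair; clause-sets finite sets of clauses; $\bot$ empty clause. Unsatisfiable: no assignment satisfies all clauses. With distinct variables $p_{i,j}$: $\mathrm{OFPHP}^m_k$ consists of $\{p_{i,1},\dots,p_{i,k}\}$ for $i\in\{1,\dots,m\}$; $\{\overline{p_{i_1,j}},\overline{p_{i_2,j}}\}$ for $j\in\{1,\dots,k\}$, $i_1\neq i_2$; $\{\overline{p_{i,j_1}},\overline{p_{i,j_2}}\}$ for $i\in\{1,\dots,m\}$, $j_1\ne j_2$; and $\{p_{1,j},\dots,p_{m,j}\}$ for $j\in\{1,\dots,k\}$. (It is unsatisfiable when $m\ne k$.) Resolution: $C,D$ with exactly one clash $x\in C,\overline{x}\in D$ have resolvent $(C\cup D)\setminus\{x,\overline{x}\}$. Resolution tree: finite rooted tree, inner nodes with two children, labelled by clauses, inner labels resolvents of children's labels; refutation of $F$: leaves in $F$, root $\bot$. Horton–Strahler number: $0$ for one node; for root subtrees $T_1,T_2$: $\mathrm{hts}(T_1)+1$ if equal, else the maximum; $\mathrm{hd}(F)$ minimum Horton–Strahler number of a refutation. Asymmetric width: $\mathrm{whd}(T)=0$ for one node; otherwise $\max(\mathrm{whd}(T_1),\mathrm{whd}(T_2),\min(|C_1|,|C_2|))$ with $C_1,C_2$ the root children's labels; $\mathrm{whd}(F)$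 minimum over refutations. -}

module Defs where

open import Data.Nat using (ℕ; zero; suc; _≤_; _⊔_; _⊓_; _≡ᵇ_)
open import Data.Product using (_×_; _,_; Σ; ∃)
open import Data.Sum using (_⊎_)
open import Data.Bool using (if_then_else_)
open import Data.List using (List; []; _∷_; [_]; map; concatMap; upTo; length; _++_)
open import Data.List.Membership.Propositional using (_∈_)
open import Data.List.Relation.Unary.Unique.Propositional using (Unique)
open import Relation.Binary.PropositionalEquality using (_≡_; _≢_)
open import Relation.Nullary using (¬_)

-- Variables: the paper's distinct variables p_{i,j} are the pairs (i , j).
Var : Set
Var = ℕ × ℕ

data Literal : Set where
  pos : Var → Literal
  neg : Var → Literal

comp : Literal → Literal
comp (pos v) = neg v
comp (neg v) = pos v

-- A clause is represented by a list of literals; it is a genuine clause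
-- (finite set, no complementary pair) when it satisfies IsClause.
-- Its cardinality is then the length of the list.
Clause : Set
Clause = List Literal

IsClause : Clause → Set
IsClause C = Unique C × (∀ x → x ∈ C → ¬ (comp x ∈ C))

_≈C_ : Clause → Clause → Set
C ≈C D = ∀ x → (x ∈ C → x ∈ D) × (x ∈ D → x ∈ C)

ClauseSet : Set
ClauseSet = List Clause

_∈F_ : Clause → ClauseSet → Set
C ∈F F = Σ Clause λ D → D ∈ F × (C ≈C D)

IsResolvent : Clause → Clause → Clause → Set
IsResolvent C D R =
  Σ Literal λ x →
    (x ∈ C) × (comp x ∈ D)
    × (∀ y → y ∈ C → comp y ∈ D → y ≡ x)
    × (∀ l → (l ∈ R → (l ∈ C ⊎ l ∈ D) × l ≢ x × l ≢ comp x)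
           × ((l ∈ C ⊎ l ∈ D) → l ≢ x → l ≢ comp x → l ∈ R))

data RTree : Set where
  leaf : Clause → RTree
  node : Clause → RTree → RTree → RTree

label : RTree → Clause
label (leaf C)     = C
label (node C _ _) = C

data IsResTree : RTree → Set where
  leaf : ∀ {C} → IsClause C → IsResTree (leaf C)
  node : ∀ {C T₁ T₂} → IsClause C → IsResTree T₁ → IsResTree T₂ →
         IsResolvent (label T₁) (label T₂) C → IsResTree (node C T₁ T₂)

LeavesIn : ClauseSet → RTree → Set
LeavesIn F (leaf C)       = C ∈F F
LeavesIn F (node _ T₁ T₂) = LeavesIn F T₁ × LeavesIn F T₂

IsRefutation : ClauseSet → RTree → Set
IsRefutation F T = IsResTree T × LeavesIn F T × label T ≡ []

hts : RTree → ℕ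
hts (leaf _) = 0
hts (node _ T₁ T₂) with hts T₁ | hts T₂
... | a | b = if a ≡ᵇ b then suc a else a ⊔ b

whdT : RTree → ℕ
whdT (leaf _) = 0
whdT (node _ T₁ T₂) =
  (whdT T₁ ⊔ whdT T₂) ⊔ (length (label T₁) ⊓ length (label T₂))

IsMinOverRefutations : (RTree → ℕ) → ClauseSet → ℕ → Set
IsMinOverRefutations f F n =
  (Σ RTree λ T → IsRefutation F T × f T ≡ n)
  × (∀ T → IsRefutation F T → n ≤ f T)

hdIs : ClauseSet → ℕ → Set
hdIs = IsMinOverRefutations hts

whdIs : ClauseSet → ℕ → Set
whdIs = IsMinOverRefutations whdT

range : ℕ → List ℕ
range n = map suc (upTo n)

distinctPairs : ℕ → List (ℕ × ℕ)
distinctPairs n =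
  concatMap (λ a → concatMap (λ b → if a ≡ᵇ b then [] else [ (a , b) ]) (range n)) (range n)

OFPHP : ℕ → ℕ → ClauseSet
OFPHP m k =
     map (λ i → map (λ j → pos (i , j)) (range k)) (range m)
  ++ concatMap (λ j → map (λ { (i₁ , i₂) → neg (i₁ , j) ∷ neg (i₂ , j) ∷ [] }) (distinctPairs m)) (range k)
  ++ concatMap (λ i → map (λ { (j₁ , j₂) → neg (i , j₁) ∷ neg (i , j₂) ∷ [] }) (distinctPairs k)) (range m)
  ++ map (λ j → map (λ i → pos (i , j)) (range m)) (range k)

module Submission where

-- Lower bounds: an adversary walks from the root of a refutation towards a leaf, keeping
-- a partial matching φ of pigeons to holes that falsifies the current clause; no axiom is
-- falsified by a matching of fewer than n = min(m,k) pairs. At a resolution whose variable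
-- φ leaves open, φ can be extended so as to falsify either premise. Following both premises
-- gives n ≤ hts T + |φ|. For the asymmetric width one follows the shorter premise, after
-- shrinking φ to one pair per literal, so |φ| stays below its length, which is < n.
--
-- Upper bounds: if F contains the pigeonhole clauses for M > H pigeons and H holes, place
-- pigeons 1, 2, … in turn. The clause of the next pigeon is resolved against the
-- refutations obtained by putting it into each free hole, and then against the collision
-- clauses of the holes already taken. The Horton–Strahler number stays at most the number
-- of free holes, and every resolution has a premise with at most H (or 2) literals.
-- OFPHP m k contains such clauses with the roles of pigeons and holes either way round.

open import Defs
open import Data.Bool using (true; false; T; if_then_else_)
open import Data.Empty using (⊥; ⊥-elim)
open import Data.List using (List; []; _∷_; map; length; _++_; filter; deduplicate; concatMap; upTo)
open import Data.List.Properties using (length-map; length-applyUpTo; filter-notAll; length-filter; length-++)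
open import Data.List.Membership.Propositional using (_∈_; _∉_; find; lose)
open import Data.List.Membership.Propositional.Properties
open import Data.List.Relation.Unary.Any using (here; there; any?)
import Data.List.Relation.Unary.All as All
open import Data.List.Relation.Unary.AllPairs using () renaming ([] to []ᵃ; _∷_ to _∷ᵃ_)
open import Data.List.Relation.Unary.Unique.Propositional using (Unique)
open import Data.List.Relation.Binary.Subset.Propositional using (_⊆_)
import Data.List.Relation.Unary.Unique.Propositional.Properties as Unique
import Data.List.Relation.Unary.Unique.DecPropositional.Properties as UniqueDec
open import Data.Nat using (ℕ; zero; suc; _≤_; _<_; _⊔_; _⊓_; _≡ᵇ_; z≤n; s≤s; _+_; pred; _≟_; _≤?_)
open import Data.Nat.Properties
open import Data.Product using (_×_; _,_; ∃-syntax; proj₁; proj₂)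
open import Data.Product.Properties using (≡-dec)
open import Data.Sum using (_⊎_; inj₁; inj₂; [_,_]′)
open import Function using (_∘_; case_of_)
open import Relation.Binary.Definitions using (DecidableEquality; tri<; tri≈; tri>)
open import Relation.Binary.PropositionalEquality using (_≡_; _≢_; refl; sym; trans; cong; subst)
open import Relation.Nullary using (¬_; Dec; yes; no; ¬?)
open import Relation.Nullary.Decidable using (decidable-stable; _⊎-dec_; map′)
open import Data.List.Membership.DecPropositional _≟_ using () renaming (_∈?_ to _∈ℕ?_)

var : Literal → Var
var (pos v) = v
var (neg v) = v

_≟ₗ_ : DecidableEquality Literal
pos u ≟ₗ pos w = map′ (cong pos) (cong var) (≡-dec _≟_ _≟_ u w)
neg u ≟ₗ neg w = map′ (cong neg) (cong var) (≡-dec _≟_ _≟_ u w)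
pos u ≟ₗ neg w = no λ ()
neg u ≟ₗ pos w = no λ ()

comp-involutive : ∀ l → comp (comp l) ≡ l
comp-involutive (pos v) = refl
comp-involutive (neg v) = refl

comp-injective : ∀ {l l′} → comp l ≡ comp l′ → l ≡ l′
comp-injective {pos _} {pos _} refl = refl
comp-injective {neg _} {neg _} refl = refl

var-comp : ∀ l → var (comp l) ≡ var l
var-comp (pos v) = refl
var-comp (neg v) = refl

∈-range⁺ : ∀ {x n} → 1 ≤ x → x ≤ n → x ∈ range n
∈-range⁺ {suc x} (s≤s _) x<n = ∈-map⁺ suc (∈-upTo⁺ x<n)

length-range : ∀ n → length (range n) ≡ n
length-range n = trans (length-map suc (upTo n)) (length-applyUpTo (λ x → x) n)

range-unique : ∀ n → Unique (range n)
range-unique n = Unique.map⁺ suc-injective (Unique.upTo⁺ n)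

module _ {A : Set} (_≟ᴬ_ : DecidableEquality A) where

  length-filter-≢ : ∀ {x xs} → x ∈ xs → length (filter (λ y → ¬? (y ≟ᴬ x)) xs) < length xs
  length-filter-≢ x∈xs = filter-notAll _ _ (lose x∈xs λ x≢x → x≢x refl)

  Unique⇒length≤ : ∀ {xs ys : List A} → Unique xs → (∀ {x} → x ∈ xs → x ∈ ys) → length xs ≤ length ys
  Unique⇒length≤ {[]} _ _ = z≤n
  Unique⇒length≤ {x ∷ xs} {ys} (x∉xs ∷ᵃ xs!) xs⊆ys =
    ≤-trans (s≤s (Unique⇒length≤ xs! xs⊆ys∖x)) (length-filter-≢ (xs⊆ys (here refl)))
    where
    xs⊆ys∖x : ∀ {y} → y ∈ xs → y ∈ filter (λ y → ¬? (y ≟ᴬ x)) ys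
    xs⊆ys∖x y∈xs = ∈-filter⁺ _ (xs⊆ys (there y∈xs)) λ { refl → All.lookup x∉xs y∈xs refl }

fresh : ∀ n (ys : List ℕ) → length ys < n → ∃[ b ] b ∈ range n × b ∉ ys
fresh n ys |ys|<n with any? (λ b → ¬? (b ∈ℕ? ys)) (range n)
... | yes found = find found
... | no none = ⊥-elim (<⇒≱ |ys|<n (subst (_≤ length ys) (length-range n)
                  (Unique⇒length≤ _≟_ (range-unique n) range⊆ys)))
  where
  range⊆ys : range n ⊆ ys
  range⊆ys {b} b∈ = decidable-stable (b ∈ℕ? ys) λ b∉ → none (lose b∈ b∉)

pigeonClause : ℕ → ℕ → Clause
pigeonClause k i = map (λ j → pos (i , j)) (range k)

holeClause : ℕ → ℕ → Clause
holeClause m j = map (λ i → pos (i , j)) (range m)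

sharedHoleClause : ℕ → ℕ × ℕ → Clause
sharedHoleClause j (i₁ , i₂) = neg (i₁ , j) ∷ neg (i₂ , j) ∷ []

sharedPigeonClause : ℕ → ℕ × ℕ → Clause
sharedPigeonClause i (j₁ , j₂) = neg (i , j₁) ∷ neg (i , j₂) ∷ []

sharedHoleClauses : ℕ → ℕ → ClauseSet
sharedHoleClauses m k = concatMap (λ j → map (sharedHoleClause j) (distinctPairs m)) (range k)

sharedPigeonClauses : ℕ → ℕ → ClauseSet
sharedPigeonClauses m k = concatMap (λ i → map (sharedPigeonClause i) (distinctPairs k)) (range m)

data Axiom (m k : ℕ) : Clause → Set where
  pigeon       : ∀ {i} → i ∈ range m → Axiom m k (pigeonClause k i)
  hole         : ∀ {j} → j ∈ range k → Axiom m k (holeClause m j)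
  sharedHole   : ∀ j {i₁ i₂} → i₁ ≢ i₂ → Axiom m k (sharedHoleClause j (i₁ , i₂))
  sharedPigeon : ∀ i {j₁ j₂} → j₁ ≢ j₂ → Axiom m k (sharedPigeonClause i (j₁ , j₂))

∈-distinctPairs⁻ : ∀ n {a b} → (a , b) ∈ distinctPairs n → a ≢ b
∈-distinctPairs⁻ n p∈ with find (∈-concatMap⁻ _ {xs = range n} p∈)
... | a , _ , p∈a with find (∈-concatMap⁻ _ {xs = range n} p∈a)
...   | b , _ , p∈ab = singleton-distinct a b p∈ab
  where
  singleton-distinct : ∀ a b {p} → p ∈ (if a ≡ᵇ b then [] else (a , b) ∷ []) → proj₁ p ≢ proj₂ p
  singleton-distinct a b with a ≡ᵇ b in a≡ᵇb
  ... | true = λ ()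
  ... | false = λ { (here refl) refl → subst T a≡ᵇb (≡⇒≡ᵇ a a refl) }

∈-distinctPairs⁺ : ∀ n {a b} → a ∈ range n → b ∈ range n → a ≢ b → (a , b) ∈ distinctPairs n
∈-distinctPairs⁺ n {a} {b} a∈ b∈ a≢b =
  ∈-concatMap⁺ _ {xs = range n} (lose a∈ (∈-concatMap⁺ _ {xs = range n} (lose b∈ singleton)))
  where
  singleton : (a , b) ∈ (if a ≡ᵇ b then [] else (a , b) ∷ [])
  singleton with a ≡ᵇ b in a≡ᵇb
  ... | true = ⊥-elim (a≢b (≡ᵇ⇒≡ a b (subst T (sym a≡ᵇb) _)))
  ... | false = here refl

axiom-shape : ∀ {m k D} → D ∈ OFPHP m k → Axiom m k D
axiom-shape {m} {k} D∈ with ∈-++⁻ _ D∈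
... | inj₁ D∈P with ∈-map⁻ (pigeonClause k) D∈P
...   | i , i∈ , refl = pigeon i∈
axiom-shape {m} {k} D∈ | inj₂ D∈N with ∈-++⁻ _ D∈N
... | inj₁ D∈N₁ with find (∈-concatMap⁻ _ {xs = range k} D∈N₁)
...   | j , _ , D∈N₁ʲ with ∈-map⁻ (sharedHoleClause j) D∈N₁ʲ
...     | (i₁ , i₂) , i₁i₂∈ , refl = sharedHole j (∈-distinctPairs⁻ m i₁i₂∈)
axiom-shape {m} {k} D∈ | inj₂ D∈N | inj₂ D∈N′ with ∈-++⁻ _ D∈N′
... | inj₁ D∈N₂ with find (∈-concatMap⁻ _ {xs = range m} D∈N₂)
...   | i , _ , D∈N₂ⁱ with ∈-map⁻ (sharedPigeonClause i) D∈N₂ⁱ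
...     | (j₁ , j₂) , j₁j₂∈ , refl = sharedPigeon i (∈-distinctPairs⁻ k j₁j₂∈)
axiom-shape {m} {k} D∈ | inj₂ D∈N | inj₂ D∈N′ | inj₂ D∈H with ∈-map⁻ (holeClause m) D∈H
... | j , j∈ , refl = hole j∈

∈⇒∈F : ∀ {C F} → C ∈ F → C ∈F F
∈⇒∈F C∈F = _ , C∈F , λ _ → (λ l∈ → l∈) , (λ l∈ → l∈)

pigeonClause∈F : ∀ {m k i} → i ∈ range m → pigeonClause k i ∈F OFPHP m k
pigeonClause∈F {k = k} i∈ = ∈⇒∈F (∈-++⁺ˡ (∈-map⁺ (pigeonClause k) i∈))

holeClause∈F : ∀ {m k j} → j ∈ range k → holeClause m j ∈F OFPHP m k
holeClause∈F {m} {k} j∈ =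
  ∈⇒∈F (∈-++⁺ʳ (map (pigeonClause k) (range m)) (∈-++⁺ʳ (sharedHoleClauses m k)
       (∈-++⁺ʳ (sharedPigeonClauses m k) (∈-map⁺ (holeClause m) j∈))))

sharedHole∈F : ∀ {m k j i₁ i₂} → j ∈ range k → i₁ ∈ range m → i₂ ∈ range m → i₁ ≢ i₂ →
               sharedHoleClause j (i₁ , i₂) ∈F OFPHP m k
sharedHole∈F {m} {k} {j} j∈ i₁∈ i₂∈ i₁≢i₂ =
  ∈⇒∈F (∈-++⁺ʳ (map (pigeonClause k) (range m))
       (∈-++⁺ˡ (∈-concatMap⁺ (λ j → map (sharedHoleClause j) (distinctPairs m))
         (lose j∈ (∈-map⁺ (sharedHoleClause j) (∈-distinctPairs⁺ m i₁∈ i₂∈ i₁≢i₂))))))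

sharedPigeon∈F : ∀ {m k i j₁ j₂} → i ∈ range m → j₁ ∈ range k → j₂ ∈ range k → j₁ ≢ j₂ →
                 sharedPigeonClause i (j₁ , j₂) ∈F OFPHP m k
sharedPigeon∈F {m} {k} {i} i∈ j₁∈ j₂∈ j₁≢j₂ =
  ∈⇒∈F (∈-++⁺ʳ (map (pigeonClause k) (range m)) (∈-++⁺ʳ (sharedHoleClauses m k)
       (∈-++⁺ˡ (∈-concatMap⁺ (λ i → map (sharedPigeonClause i) (distinctPairs k))
         (lose i∈ (∈-map⁺ (sharedPigeonClause i) (∈-distinctPairs⁺ k j₁∈ j₂∈ j₁≢j₂)))))))

root-isClause : ∀ {T} → IsResTree T → IsClause (label T)
root-isClause (leaf C!) = C!
root-isClause (node C! _ _ _) = C!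

clash-of-resolvent : ∀ {C D R} → IsClause C → IsClause D → IsResolvent C D R →
  ∃[ x ] x ∈ C × comp x ∈ D
         × (∀ {l} → l ∈ C → l ≢ x → l ∈ R) × (∀ {l} → l ∈ D → l ≢ comp x → l ∈ R)
clash-of-resolvent {D = D} (_ , C-consistent) (_ , D-consistent) (x , x∈C , x̄∈D , _ , R≈) =
  x , x∈C , x̄∈D ,
  (λ l∈C l≢x → proj₂ (R≈ _) (inj₁ l∈C) l≢x λ { refl → C-consistent x x∈C l∈C }) ,
  (λ l∈D l≢x̄ → proj₂ (R≈ _) (inj₂ l∈D)
     (λ { refl → D-consistent (comp x) x̄∈D (subst (_∈ D) (sym (comp-involutive x)) l∈D) }) l≢x̄)

-- hts (node C T₁ T₂) computes to htsJoin (hts T₁) (hts T₂).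
htsJoin : ℕ → ℕ → ℕ
htsJoin a b = if a ≡ᵇ b then suc a else a ⊔ b

data HtsJoinView (a b : ℕ) : ℕ → Set where
  equal   : a ≡ b → HtsJoinView a b (suc a)
  unequal : a ≢ b → HtsJoinView a b (a ⊔ b)

htsJoin-view : ∀ a b → HtsJoinView a b (htsJoin a b)
htsJoin-view a b with a ≡ᵇ b in a≡ᵇb
... | true = equal (≡ᵇ⇒≡ a b (subst T (sym a≡ᵇb) _))
... | false = unequal λ { refl → subst T a≡ᵇb (≡⇒≡ᵇ a a refl) }

≤-htsJoinˡ : ∀ a b → a ≤ htsJoin a b
≤-htsJoinˡ a b with htsJoin a b | htsJoin-view a b
... | _ | equal _ = n≤1+n a
... | _ | unequal _ = m≤m⊔n a b

≤-htsJoinʳ : ∀ a b → b ≤ htsJoin a b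
≤-htsJoinʳ a b with htsJoin a b | htsJoin-view a b
... | _ | equal refl = n≤1+n a
... | _ | unequal _ = m≤n⊔m a b

⊓<htsJoin : ∀ a b → a ⊓ b < htsJoin a b
⊓<htsJoin a b with htsJoin a b | htsJoin-view a b
... | _ | equal refl = s≤s (m⊓n≤m a a)
... | _ | unequal a≢b with ≤-total a b
...   | inj₁ a≤b = ≤-trans (s≤s (m⊓n≤m a b)) (≤-trans (≤∧≢⇒< a≤b a≢b) (m≤n⊔m a b))
...   | inj₂ b≤a = ≤-trans (s≤s (m⊓n≤n a b)) (≤-trans (≤∧≢⇒< b≤a (a≢b ∘ sym)) (m≤m⊔n a b))

htsJoin-≤ : ∀ {a b X} → a ≤ X → b < X → htsJoin a b ≤ X
htsJoin-≤ {a} {b} a≤X b<X with htsJoin a b | htsJoin-view a b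
... | _ | equal refl = b<X
... | _ | unequal _  = ⊔-lub a≤X (<⇒≤ b<X)

htsJoin-≤-suc : ∀ {a b X} → a ≤ X → b ≤ X → htsJoin a b ≤ suc X
htsJoin-≤-suc {a} {b} a≤X b≤X with htsJoin a b | htsJoin-view a b
... | _ | equal refl = s≤s a≤X
... | _ | unequal _  = m≤n⇒m≤1+n (⊔-lub a≤X b≤X)

htsJoin-zeroˡ-≤ : ∀ {b X} → b ≤ X → 1 ≤ X → htsJoin 0 b ≤ X
htsJoin-zeroˡ-≤ {b} b≤X 1≤X with htsJoin 0 b | htsJoin-view 0 b
... | _ | equal refl = 1≤X
... | _ | unequal _  = b≤X

htsJoin-zeroʳ-≤ : ∀ a → htsJoin a 0 ≤ 1 ⊔ a
htsJoin-zeroʳ-≤ a with htsJoin a 0 | htsJoin-view a 0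
... | _ | equal refl = ≤-refl
... | _ | unequal _  = ≤-trans (≤-reflexive (⊔-identityʳ a)) (m≤n⊔m 1 a)

-- Bound on the Horton–Strahler number of a left-leaning chain that starts at a
-- leaf and resolves, c times, with trees of number at most h ≥ 1.
chainHts : ℕ → ℕ → ℕ
chainHts h zero          = zero
chainHts h (suc zero)    = h
chainHts h (suc (suc _)) = suc h

chainHts-mono : ∀ h c → chainHts h c ≤ chainHts h (suc c)
chainHts-mono h zero          = z≤n
chainHts-mono h (suc zero)    = n≤1+n h
chainHts-mono h (suc (suc c)) = ≤-refl

chainHts-step : ∀ {h s t} c → 1 ≤ h → s ≤ chainHts h c → t ≤ h → htsJoin s t ≤ chainHts h (suc c)
chainHts-step {s = zero} zero 1≤h _ t≤h = htsJoin-zeroˡ-≤ t≤h 1≤h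
chainHts-step (suc zero)    _ s≤h t≤h = htsJoin-≤-suc s≤h t≤h
chainHts-step (suc (suc c)) _ s≤  t≤h = htsJoin-≤ s≤ (s≤s t≤h)

chainHts-end : ∀ L → chainHts (1 ⊔ pred L) L ≤ 1 ⊔ L
chainHts-end zero          = z≤n
chainHts-end (suc zero)    = ≤-refl
chainHts-end (suc (suc L)) = ≤-refl

whdT-left : ∀ C T₁ T₂ → whdT T₁ ≤ whdT (node C T₁ T₂)
whdT-left C T₁ T₂ = ≤-trans (m≤m⊔n _ _) (m≤m⊔n _ _)

whdT-right : ∀ C T₁ T₂ → whdT T₂ ≤ whdT (node C T₁ T₂)
whdT-right C T₁ T₂ = ≤-trans (m≤n⊔m (whdT T₁) _) (m≤m⊔n _ _)

whdT-premises : ∀ C T₁ T₂ → length (label T₁) ⊓ length (label T₂) ≤ whdT (node C T₁ T₂)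
whdT-premises C T₁ T₂ = m≤n⊔m (whdT T₁ ⊔ whdT T₂) _

module Adversary (m k : ℕ) where

  n : ℕ
  n = m ⊓ k

  Conflicts : Var → Var → Set
  Conflicts (a′ , b′) (a , b) = (a′ ≡ a × b′ ≢ b) ⊎ (a′ ≢ a × b′ ≡ b)

  -- The literals whose value the matching φ forces to be false; variables outside the
  -- m × k grid occur in no axiom and are set to false.
  Falsified : List Var → Literal → Set
  Falsified φ (neg v)       = v ∈ φ
  Falsified φ (pos (a , b)) = a ∉ range m ⊎ b ∉ range k ⊎ ∃[ p ] p ∈ φ × Conflicts p (a , b)

  FalsifiedClause : List Var → Clause → Set
  FalsifiedClause φ C = ∀ {l} → l ∈ C → Falsified φ l

  Falsified-mono : ∀ {φ ψ} l → φ ⊆ ψ → Falsified φ l → Falsified ψ l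
  Falsified-mono (neg v) φ⊆ψ v∈φ = φ⊆ψ v∈φ
  Falsified-mono (pos _) φ⊆ψ (inj₁ a∉) = inj₁ a∉
  Falsified-mono (pos _) φ⊆ψ (inj₂ (inj₁ b∉)) = inj₂ (inj₁ b∉)
  Falsified-mono (pos _) φ⊆ψ (inj₂ (inj₂ (p , p∈φ , conflict))) = inj₂ (inj₂ (p , φ⊆ψ p∈φ , conflict))

  record IsMatching (φ : List Var) : Set where
    field
      functional : ∀ {p q} → p ∈ φ → q ∈ φ → proj₁ p ≡ proj₁ q → proj₂ p ≡ proj₂ q
      injective  : ∀ {p q} → p ∈ φ → q ∈ φ → proj₂ p ≡ proj₂ q → proj₁ p ≡ proj₁ q
      in-range   : ∀ {p} → p ∈ φ → proj₁ p ∈ range m × proj₂ p ∈ range k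
  open IsMatching

  Free : List Var → Var → Set
  Free φ (a , b) = a ∈ range m × b ∈ range k × (∀ {p} → p ∈ φ → proj₁ p ≢ a × proj₂ p ≢ b)

  []-isMatching : IsMatching []
  []-isMatching = record { functional = λ () ; injective = λ () ; in-range = λ () }

  ⊆-isMatching : ∀ {φ ψ} → ψ ⊆ φ → IsMatching φ → IsMatching ψ
  ⊆-isMatching ψ⊆φ M = record
    { functional = λ p∈ q∈ → functional M (ψ⊆φ p∈) (ψ⊆φ q∈)
    ; injective  = λ p∈ q∈ → injective M (ψ⊆φ p∈) (ψ⊆φ q∈)
    ; in-range   = λ p∈ → in-range M (ψ⊆φ p∈)
    }

  ∷-isMatching : ∀ {φ} p → IsMatching φ → Free φ p → IsMatching (p ∷ φ)
  ∷-isMatching {φ} (a , b) M (a∈ , b∈ , p-fresh) = record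
    { functional = functional′ ; injective = injective′ ; in-range = in-range′ }
    where
    functional′ : ∀ {p q} → p ∈ (a , b) ∷ φ → q ∈ (a , b) ∷ φ → proj₁ p ≡ proj₁ q → proj₂ p ≡ proj₂ q
    functional′ (here refl) (here refl) _   = refl
    functional′ (here refl) (there q∈) eq   = ⊥-elim (proj₁ (p-fresh q∈) (sym eq))
    functional′ (there p∈) (here refl) eq   = ⊥-elim (proj₁ (p-fresh p∈) eq)
    functional′ (there p∈) (there q∈)       = functional M p∈ q∈
    injective′ : ∀ {p q} → p ∈ (a , b) ∷ φ → q ∈ (a , b) ∷ φ → proj₂ p ≡ proj₂ q → proj₁ p ≡ proj₁ q
    injective′ (here refl) (here refl) _    = refl
    injective′ (here refl) (there q∈) eq    = ⊥-elim (proj₂ (p-fresh q∈) (sym eq))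
    injective′ (there p∈) (here refl) eq    = ⊥-elim (proj₂ (p-fresh p∈) eq)
    injective′ (there p∈) (there q∈)        = injective M p∈ q∈
    in-range′ : ∀ {p} → p ∈ (a , b) ∷ φ → proj₁ p ∈ range m × proj₂ p ∈ range k
    in-range′ (here refl) = a∈ , b∈
    in-range′ (there p∈)  = in-range M p∈

  Free-⊆ : ∀ {φ ψ} v → ψ ⊆ φ → Free φ v → Free ψ v
  Free-⊆ (a , b) ψ⊆φ (a∈ , b∈ , v-fresh) = a∈ , b∈ , v-fresh ∘ ψ⊆φ

  var-trichotomy : ∀ φ v → Falsified φ (pos v) ⊎ Falsified φ (neg v) ⊎ Free φ v
  var-trichotomy φ (a , b) with a ∈ℕ? range m | b ∈ℕ? range k
  ... | no a∉ | _ = inj₁ (inj₁ a∉)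
  ... | yes _ | no b∉ = inj₁ (inj₂ (inj₁ b∉))
  ... | yes a∈ | yes b∈ with any? (λ p → (proj₁ p ≟ a) ⊎-dec (proj₂ p ≟ b)) φ
  ...   | no none = inj₂ (inj₂ (a∈ , b∈ , λ p∈ → none ∘ lose p∈ ∘ inj₁ , none ∘ lose p∈ ∘ inj₂))
  ...   | yes some with find some
  ...     | (a′ , b′) , p∈ , shares with a′ ≟ a | b′ ≟ b
  ...       | yes refl | yes refl = inj₂ (inj₁ p∈)
  ...       | yes a′≡a | no b′≢b  = inj₁ (inj₂ (inj₂ (_ , p∈ , inj₁ (a′≡a , b′≢b))))
  ...       | no a′≢a  | yes b′≡b = inj₁ (inj₂ (inj₂ (_ , p∈ , inj₂ (a′≢a , b′≡b))))
  ...       | no a′≢a  | no b′≢b  = ⊥-elim ([ a′≢a , b′≢b ]′ shares)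

  trichotomy : ∀ φ l → Falsified φ l ⊎ Falsified φ (comp l) ⊎ Free φ (var l)
  trichotomy φ (pos v) = var-trichotomy φ v
  trichotomy φ (neg v) with var-trichotomy φ v
  ... | inj₁ pos-false          = inj₂ (inj₁ pos-false)
  ... | inj₂ (inj₁ neg-false)   = inj₁ neg-false
  ... | inj₂ (inj₂ v-free)      = inj₂ (inj₂ v-free)

  -- p_{a,b} is falsified by sending pigeon a to another hole, so two free holes are needed.
  extend-falsifying : ∀ {φ} l → IsMatching φ → Free φ (var l) → 2 + length φ ≤ k →
                      ∃[ p ] IsMatching (p ∷ φ) × Falsified (p ∷ φ) l
  extend-falsifying (neg v) M v-free _ = v , ∷-isMatching v M v-free , here refl
  extend-falsifying {φ} (pos (a , b)) M (a∈ , b∈ , ab-fresh) 2+|φ|≤k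
    with fresh k (b ∷ map proj₂ φ) (subst (λ x → suc x < k) (sym (length-map proj₂ φ)) 2+|φ|≤k)
  ... | b′ , b′∈ , b′∉ =
    (a , b′) ,
    ∷-isMatching (a , b′) M
      (a∈ , b′∈ , λ p∈ → proj₁ (ab-fresh p∈) , λ { refl → b′∉ (there (∈-map⁺ proj₂ p∈)) }) ,
    inj₂ (inj₂ (_ , here refl , inj₁ (refl , λ { refl → b′∉ (here refl) })))

  matched-not-falsified : ∀ {φ a b} → IsMatching φ → (a , b) ∈ φ → ¬ Falsified φ (pos (a , b))
  matched-not-falsified M p∈ (inj₁ a∉) = a∉ (proj₁ (in-range M p∈))
  matched-not-falsified M p∈ (inj₂ (inj₁ b∉)) = b∉ (proj₂ (in-range M p∈))
  matched-not-falsified M p∈ (inj₂ (inj₂ (q , q∈ , inj₁ (same-pigeon , b-differs)))) =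
    b-differs (functional M q∈ p∈ same-pigeon)
  matched-not-falsified M p∈ (inj₂ (inj₂ (q , q∈ , inj₂ (a-differs , same-hole)))) =
    a-differs (injective M q∈ p∈ same-hole)

  pigeonClause-not-falsified : ∀ {φ i} → IsMatching φ → length φ < k → i ∈ range m →
                               ¬ FalsifiedClause φ (pigeonClause k i)
  pigeonClause-not-falsified {φ} {i} M |φ|<k i∈ falsified
    with fresh k (map proj₂ φ) (subst (_< k) (sym (length-map proj₂ φ)) |φ|<k)
  ... | b , b∈ , b∉ with falsified (∈-map⁺ (λ j → pos (i , j)) b∈)
  ...   | inj₁ i∉ = i∉ i∈
  ...   | inj₂ (inj₁ b∉k) = b∉k b∈
  ...   | inj₂ (inj₂ (p , p∈ , inj₂ (_ , refl))) = b∉ (∈-map⁺ proj₂ p∈)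
  ...   | inj₂ (inj₂ ((_ , b₀) , p∈ , inj₁ (refl , _))) =
    matched-not-falsified M p∈ (falsified (∈-map⁺ (λ j → pos (i , j)) (proj₂ (in-range M p∈))))

  holeClause-not-falsified : ∀ {φ j} → IsMatching φ → length φ < m → j ∈ range k →
                             ¬ FalsifiedClause φ (holeClause m j)
  holeClause-not-falsified {φ} {j} M |φ|<m j∈ falsified
    with fresh m (map proj₁ φ) (subst (_< m) (sym (length-map proj₁ φ)) |φ|<m)
  ... | a , a∈ , a∉ with falsified (∈-map⁺ (λ i → pos (i , j)) a∈)
  ...   | inj₁ a∉m = a∉m a∈
  ...   | inj₂ (inj₁ j∉) = j∉ j∈
  ...   | inj₂ (inj₂ (p , p∈ , inj₁ (refl , _))) = a∉ (∈-map⁺ proj₁ p∈)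
  ...   | inj₂ (inj₂ ((a₀ , _) , p∈ , inj₂ (_ , refl))) =
    matched-not-falsified M p∈ (falsified (∈-map⁺ (λ i → pos (i , j)) (proj₁ (in-range M p∈))))

  axiom-not-falsified : ∀ {φ C} → IsMatching φ → length φ < n → C ∈F OFPHP m k → ¬ FalsifiedClause φ C
  axiom-not-falsified {φ} M |φ|<n (D , D∈ , C≈D) falsified =
    not-falsified (axiom-shape D∈) (falsified ∘ proj₂ (C≈D _))
    where
    not-falsified : ∀ {D} → Axiom m k D → ¬ FalsifiedClause φ D
    not-falsified (pigeon i∈) = pigeonClause-not-falsified M (≤-trans |φ|<n (m⊓n≤n m k)) i∈
    not-falsified (hole j∈)   = holeClause-not-falsified M (≤-trans |φ|<n (m⊓n≤m m k)) j∈
    not-falsified (sharedHole _ i₁≢i₂) f   = i₁≢i₂ (injective M (f (here refl)) (f (there (here refl))) refl)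
    not-falsified (sharedPigeon _ j₁≢j₂) f = j₁≢j₂ (functional M (f (here refl)) (f (there (here refl))) refl)

  falsified-premise : ∀ {φ R C x} → FalsifiedClause φ R → Falsified φ x →
                      (∀ {l} → l ∈ C → l ≢ x → l ∈ R) → FalsifiedClause φ C
  falsified-premise {x = x} R-false x-false C∖x⊆R {l} l∈C with l ≟ₗ x
  ... | yes refl = x-false
  ... | no l≢x   = R-false (C∖x⊆R l∈C l≢x)

  n≤hts+|φ| : ∀ {T φ} → IsResTree T → LeavesIn (OFPHP m k) T → IsMatching φ →
                    FalsifiedClause φ (label T) → n ≤ hts T + length φ
  n≤hts+|φ| {leaf C} {φ} _ C∈F M falsified with n ≤? length φ
  ... | yes n≤|φ| = n≤|φ|
  ... | no n≰|φ|  = ⊥-elim (axiom-not-falsified M (≰⇒> n≰|φ|) C∈F falsified)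
  n≤hts+|φ| {node C T₁ T₂} {φ} (node _ t₁ t₂ R) (leaves₁ , leaves₂) M falsified
    with clash-of-resolvent (root-isClause t₁) (root-isClause t₂) R
  ... | x , x∈ , x̄∈ , C₁∖x⊆C , C₂∖x̄⊆C with trichotomy φ x
  ...   | inj₁ x-false =
    ≤-trans (n≤hts+|φ| t₁ leaves₁ M (falsified-premise falsified x-false C₁∖x⊆C))
            (+-monoˡ-≤ (length φ) (≤-htsJoinˡ (hts T₁) (hts T₂)))
  ...   | inj₂ (inj₁ x̄-false) =
    ≤-trans (n≤hts+|φ| t₂ leaves₂ M (falsified-premise falsified x̄-false C₂∖x̄⊆C))
            (+-monoˡ-≤ (length φ) (≤-htsJoinʳ (hts T₁) (hts T₂)))
  ...   | inj₂ (inj₂ x-free) with 2 + length φ ≤? n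
  ...     | no n≰2+|φ| =
    ≤-trans (≤-pred (≰⇒> n≰2+|φ|)) (+-monoˡ-≤ (length φ) (≤-trans (s≤s z≤n) (⊓<htsJoin (hts T₁) (hts T₂))))
  ...     | yes 2+|φ|≤n
    with extend-falsifying x M x-free (≤-trans 2+|φ|≤n (m⊓n≤n m k))
       | extend-falsifying (comp x) M (subst (Free φ) (sym (var-comp x)) x-free) (≤-trans 2+|φ|≤n (m⊓n≤n m k))
  ...       | p₁ , M₁ , x-false | p₂ , M₂ , x̄-false = begin
    n                                               ≤⟨ ⊓-glb ih₁ ih₂ ⟩
    (h₁ + suc (length φ)) ⊓ (h₂ + suc (length φ))   ≡⟨ +-distribʳ-⊓ (suc (length φ)) h₁ h₂ ⟨
    (h₁ ⊓ h₂) + suc (length φ)                      ≡⟨ +-suc (h₁ ⊓ h₂) (length φ) ⟩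
    suc (h₁ ⊓ h₂) + length φ                        ≤⟨ +-monoˡ-≤ (length φ) (⊓<htsJoin h₁ h₂) ⟩
    htsJoin h₁ h₂ + length φ                        ∎
    where
    open ≤-Reasoning
    h₁ = hts T₁
    h₂ = hts T₂
    ih₁ : n ≤ h₁ + suc (length φ)
    ih₁ = n≤hts+|φ| t₁ leaves₁ M₁
            (falsified-premise (λ l∈ → Falsified-mono _ there (falsified l∈)) x-false C₁∖x⊆C)
    ih₂ : n ≤ h₂ + suc (length φ)
    ih₂ = n≤hts+|φ| t₂ leaves₂ M₂
            (falsified-premise (λ l∈ → Falsified-mono _ there (falsified l∈)) x̄-false C₂∖x̄⊆C)

  falsifying-witness : ∀ {φ} l → Falsified φ l → ∃[ ψ ] ψ ⊆ φ × length ψ ≤ 1 × Falsified ψ l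
  falsifying-witness (neg v) v∈φ = v ∷ [] , (λ { (here refl) → v∈φ }) , ≤-refl , here refl
  falsifying-witness (pos _) (inj₁ a∉) = [] , (λ ()) , z≤n , inj₁ a∉
  falsifying-witness (pos _) (inj₂ (inj₁ b∉)) = [] , (λ ()) , z≤n , inj₂ (inj₁ b∉)
  falsifying-witness (pos _) (inj₂ (inj₂ (p , p∈φ , conflict))) =
    p ∷ [] , (λ { (here refl) → p∈φ }) , ≤-refl , inj₂ (inj₂ (p , here refl , conflict))

  falsifying-submatching : ∀ {φ} A → FalsifiedClause φ A →
                           ∃[ ψ ] ψ ⊆ φ × length ψ ≤ length A × FalsifiedClause ψ A
  falsifying-submatching [] _ = [] , (λ ()) , z≤n , λ ()
  falsifying-submatching {φ} (l ∷ A) falsified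
    with falsifying-witness l (falsified (here refl)) | falsifying-submatching A (falsified ∘ there)
  ... | w , w⊆φ , |w|≤1 , w-falsifies | ψ , ψ⊆φ , |ψ|≤|A| , ψ-falsifies =
    w ++ ψ ,
    [ w⊆φ , ψ⊆φ ]′ ∘ ∈-++⁻ w ,
    ≤-trans (≤-reflexive (length-++ w)) (+-mono-≤ |w|≤1 |ψ|≤|A|) ,
    λ { (here refl) → Falsified-mono l ∈-++⁺ˡ w-falsifies
      ; (there l∈A) → Falsified-mono _ (∈-++⁺ʳ w) (ψ-falsifies l∈A) }

  -- Keep only the pairs of φ needed to falsify D minus l₀, then falsify l₀ by a fresh pair.
  small-falsifying-matching : ∀ {φ l₀ D} → IsMatching φ → l₀ ∈ D → Free φ (var l₀) →
    (∀ {l} → l ∈ D → l ≢ l₀ → Falsified φ l) → length D < k →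
    ∃[ ψ ] IsMatching ψ × length ψ ≤ length D × FalsifiedClause ψ D
  small-falsifying-matching {φ} {l₀} {D} M l₀∈D l₀-free D∖l₀-false |D|<k
    with falsifying-submatching (filter (λ l → ¬? (l ≟ₗ l₀)) D)
           (λ l∈ → let (l∈D , l≢l₀) = ∈-filter⁻ (λ l → ¬? (l ≟ₗ l₀)) l∈ in D∖l₀-false l∈D l≢l₀)
  ... | ψ , ψ⊆φ , |ψ|≤|D∖l₀| , ψ-falsifies
    with extend-falsifying l₀ (⊆-isMatching ψ⊆φ M) (Free-⊆ (var l₀) ψ⊆φ l₀-free)
           (≤-trans (s≤s (s≤s |ψ|≤|D∖l₀|)) (≤-trans (s≤s (length-filter-≢ _≟ₗ_ l₀∈D)) |D|<k))
  ... | p , M′ , l₀-false =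
    p ∷ ψ , M′ , ≤-trans (s≤s |ψ|≤|D∖l₀|) (length-filter-≢ _≟ₗ_ l₀∈D) , D-false
    where
    D-false : FalsifiedClause (p ∷ ψ) D
    D-false {l} l∈D with l ≟ₗ l₀
    ... | yes refl = l₀-false
    ... | no l≢l₀  = Falsified-mono l there (ψ-falsifies (∈-filter⁺ (λ l → ¬? (l ≟ₗ l₀)) l∈D l≢l₀))

  whd<n⇒¬falsified : ∀ {T φ} → IsResTree T → LeavesIn (OFPHP m k) T → whdT T < n →
                    IsMatching φ → length φ < n → ¬ FalsifiedClause φ (label T)

  refute-short-premise : ∀ {Tⱼ l₀ φ C} → IsResTree Tⱼ → LeavesIn (OFPHP m k) Tⱼ → whdT Tⱼ < n →
    length (label Tⱼ) < n → l₀ ∈ label Tⱼ → Free φ (var l₀) → (∀ {l} → l ∈ label Tⱼ → l ≢ l₀ → l ∈ C) →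
    IsMatching φ → ¬ FalsifiedClause φ C

  whd<n⇒¬falsified {leaf C} _ C∈F _ M |φ|<n = axiom-not-falsified M |φ|<n C∈F
  whd<n⇒¬falsified {node C T₁ T₂} {φ} (node _ t₁ t₂ R) (leaves₁ , leaves₂) whd<n M |φ|<n falsified
    with clash-of-resolvent (root-isClause t₁) (root-isClause t₂) R
  ... | x , x∈ , x̄∈ , C₁∖x⊆C , C₂∖x̄⊆C with trichotomy φ x
  ...   | inj₁ x-false =
    whd<n⇒¬falsified t₁ leaves₁ (≤-<-trans (whdT-left C T₁ T₂) whd<n) M |φ|<n
      (falsified-premise falsified x-false C₁∖x⊆C)
  ...   | inj₂ (inj₁ x̄-false) =
    whd<n⇒¬falsified t₂ leaves₂ (≤-<-trans (whdT-right C T₁ T₂) whd<n) M |φ|<n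
      (falsified-premise falsified x̄-false C₂∖x̄⊆C)
  ...   | inj₂ (inj₂ x-free) with ≤-total (length (label T₁)) (length (label T₂))
  ...     | inj₁ |C₁|≤|C₂| =
    refute-short-premise t₁ leaves₁ (≤-<-trans (whdT-left C T₁ T₂) whd<n)
      (subst (_< n) (m≤n⇒m⊓n≡m |C₁|≤|C₂|) (≤-<-trans (whdT-premises C T₁ T₂) whd<n))
      x∈ x-free C₁∖x⊆C M falsified
  ...     | inj₂ |C₂|≤|C₁| =
    refute-short-premise t₂ leaves₂ (≤-<-trans (whdT-right C T₁ T₂) whd<n)
      (subst (_< n) (m≥n⇒m⊓n≡n |C₂|≤|C₁|) (≤-<-trans (whdT-premises C T₁ T₂) whd<n))
      x̄∈ (subst (Free φ) (sym (var-comp x)) x-free) C₂∖x̄⊆C M falsified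

  refute-short-premise tⱼ leavesⱼ whdⱼ<n |Cⱼ|<n l₀∈ l₀-free Cⱼ∖l₀⊆C M falsified
    with small-falsifying-matching M l₀∈ l₀-free (λ l∈ l≢l₀ → falsified (Cⱼ∖l₀⊆C l∈ l≢l₀))
           (≤-trans |Cⱼ|<n (m⊓n≤n m k))
  ... | ψ , Mψ , |ψ|≤|Cⱼ| , ψ-falsifies =
    whd<n⇒¬falsified tⱼ leavesⱼ whdⱼ<n Mψ (≤-<-trans |ψ|≤|Cⱼ| |Cⱼ|<n) ψ-falsifies

  refutation-falsified : ∀ {T} → IsRefutation (OFPHP m k) T → FalsifiedClause [] (label T)
  refutation-falsified (_ , _ , root≡⊥) l∈ with () ← subst (_ ∈_) root≡⊥ l∈

  hd-lower-bound : ∀ T → IsRefutation (OFPHP m k) T → n ≤ hts T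
  hd-lower-bound T refutation@(t , leaves , _) =
    subst (n ≤_) (+-identityʳ (hts T)) (n≤hts+|φ| t leaves []-isMatching (refutation-falsified refutation))

  whd-lower-bound : ∀ T → IsRefutation (OFPHP m k) T → n ≤ whdT T
  whd-lower-bound T refutation@(t , leaves , _) with n ≤? whdT T
  ... | yes n≤whd = n≤whd
  ... | no n≰whd  = ⊥-elim (whd<n⇒¬falsified t leaves (≰⇒> n≰whd) []-isMatching
                             (≤-<-trans z≤n (≰⇒> n≰whd)) (refutation-falsified refutation))

resolvent : Literal → Clause → Clause → Clause
resolvent x C D = deduplicate _≟ₗ_ (filter (λ l → ¬? (l ≟ₗ x)) C ++ filter (λ l → ¬? (l ≟ₗ comp x)) D)

∈-resolvent⁻ : ∀ {l x C D} → l ∈ resolvent x C D → (l ∈ C × l ≢ x) ⊎ (l ∈ D × l ≢ comp x)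
∈-resolvent⁻ {x = x} {C} q with ∈-++⁻ (filter (λ l → ¬? (l ≟ₗ x)) C) (∈-deduplicate⁻ _≟ₗ_ _ q)
... | inj₁ l∈C∖x = inj₁ (∈-filter⁻ (λ l → ¬? (l ≟ₗ x)) l∈C∖x)
... | inj₂ l∈D∖x̄ = inj₂ (∈-filter⁻ (λ l → ¬? (l ≟ₗ comp x)) l∈D∖x̄)

∈-resolvent⁺ˡ : ∀ {l x C D} → l ∈ C → l ≢ x → l ∈ resolvent x C D
∈-resolvent⁺ˡ {x = x} l∈C l≢x =
  ∈-deduplicate⁺ _≟ₗ_ (∈-++⁺ˡ (∈-filter⁺ (λ l → ¬? (l ≟ₗ x)) l∈C l≢x))

∈-resolvent⁺ʳ : ∀ {l x C D} → l ∈ D → l ≢ comp x → l ∈ resolvent x C D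
∈-resolvent⁺ʳ {x = x} {C} l∈D l≢x̄ =
  ∈-deduplicate⁺ _≟ₗ_
    (∈-++⁺ʳ (filter (λ l → ¬? (l ≟ₗ x)) C) (∈-filter⁺ (λ l → ¬? (l ≟ₗ comp x)) l∈D l≢x̄))

-- A predicate Q that never holds of both l and comp l guarantees that the resolvent is a
-- clause and that x is the only clash.
resolution-step : ∀ (Q : Literal → Set) → (∀ l → Q l → ¬ Q (comp l)) →
  ∀ {T₁ T₂} x → IsResTree T₁ → IsResTree T₂ → x ∈ label T₁ → comp x ∈ label T₂ →
  (∀ {l} → l ∈ label T₁ → l ≢ x → Q l) → (∀ {l} → l ∈ label T₂ → l ≢ comp x → Q l) →
  IsResTree (node (resolvent x (label T₁) (label T₂)) T₁ T₂)
  × (∀ {l} → l ∈ resolvent x (label T₁) (label T₂) → Q l)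
resolution-step Q Q-consistent {T₁} {T₂} x t₁ t₂ x∈C x̄∈D C∖x-Q D∖x̄-Q =
  node (UniqueDec.deduplicate-! _≟ₗ_ _ , λ l l∈ l̄∈ → Q-consistent l (R-Q l∈) (R-Q l̄∈)) t₁ t₂ is-resolvent ,
  R-Q
  where
  C = label T₁
  D = label T₂
  R-Q : ∀ {l} → l ∈ resolvent x C D → Q l
  R-Q l∈ with ∈-resolvent⁻ {C = C} {D} l∈
  ... | inj₁ (l∈C , l≢x) = C∖x-Q l∈C l≢x
  ... | inj₂ (l∈D , l≢x̄) = D∖x̄-Q l∈D l≢x̄
  unique-clash : ∀ y → y ∈ C → comp y ∈ D → y ≡ x
  unique-clash y y∈C ȳ∈D with y ≟ₗ x
  ... | yes y≡x = y≡x
  ... | no y≢x  = ⊥-elim (Q-consistent y (C∖x-Q y∈C y≢x) (D∖x̄-Q ȳ∈D (y≢x ∘ comp-injective)))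
  is-resolvent : IsResolvent C D (resolvent x C D)
  is-resolvent = x , x∈C , x̄∈D , unique-clash , λ l →
    (λ l∈R → case ∈-resolvent⁻ {C = C} {D} l∈R of λ where
      (inj₁ (l∈C , l≢x)) → inj₁ l∈C , l≢x , λ { refl → proj₂ (root-isClause t₁) x x∈C l∈C }
      (inj₂ (l∈D , l≢x̄)) → inj₂ l∈D , (λ { refl → proj₂ (root-isClause t₂) x l∈D x̄∈D }) , l≢x̄) ,
    λ where
      (inj₁ l∈C) l≢x _ → ∈-resolvent⁺ˡ {D = D} l∈C l≢x
      (inj₂ l∈D) _ l≢x̄ → ∈-resolvent⁺ʳ {C = C} l∈D l≢x̄

unit-isClause : ∀ l → IsClause (l ∷ [])
unit-isClause (pos _) = All.[] ∷ᵃ []ᵃ , λ { _ (here refl) (here ()) }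
unit-isClause (neg _) = All.[] ∷ᵃ []ᵃ , λ { _ (here refl) (here ()) }

negPair-isClause : ∀ {u w} → u ≢ w → IsClause (neg u ∷ neg w ∷ [])
negPair-isClause u≢w = ((λ { refl → u≢w refl }) All.∷ All.[]) ∷ᵃ All.[] ∷ᵃ []ᵃ , consistent
  where
  consistent : ∀ l → l ∈ _ → ¬ (comp l ∈ _)
  consistent _ (here refl) (here ())
  consistent _ (here refl) (there (here ()))
  consistent _ (there (here refl)) (here ())
  consistent _ (there (here refl)) (there (here ()))

no-literals⇒≡[] : ∀ {C : Clause} → (∀ {l} → ¬ l ∈ C) → C ≡ []
no-literals⇒≡[] {[]} _ = refl
no-literals⇒≡[] {l ∷ C} no-literals = ⊥-elim (no-literals (here refl))

-- v a b is the variable "pigeon a sits in hole b".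
record ContainsPHP (F : ClauseSet) (M H : ℕ) : Set where
  field
    v           : ℕ → ℕ → Var
    v-injective : ∀ {a b a′ b′} → v a b ≡ v a′ b′ → a ≡ a′ × b ≡ b′
    pigeon∈F    : ∀ {a} → a ∈ range M → map (λ b → pos (v a b)) (range H) ∈F F
    collision∈F : ∀ {a a′ b} → a ∈ range M → a′ ∈ range M → b ∈ range H → a ≢ a′ →
                  (neg (v a b) ∷ neg (v a′ b) ∷ []) ∈F F

_∖_ : List ℕ → ℕ → List ℕ
holes ∖ b = filter (λ b′ → ¬? (b′ ≟ b)) holes

module PHPRefutation {F M H} (P : ContainsPHP F M H) (H<M : H < M) where
  open ContainsPHP P
  open import Data.List.Membership.DecPropositional _≟ₗ_ using () renaming (_∈?_ to _∈ₗ?_)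

  W : ℕ
  W = H ⊔ 2

  Placed : List Var → Literal → Set
  Placed μ l = ∃[ p ] p ∈ μ × l ≡ neg (v (proj₁ p) (proj₂ p))

  Taken : List Var → ℕ → Set
  Taken μ b = ∃[ a ] (a , b) ∈ μ

  taken? : ∀ μ b → Dec (Taken μ b)
  taken? μ b with any? (λ p → proj₂ p ≟ b) μ
  ... | yes some with find some
  ...   | (a , _) , p∈ , refl = yes (a , p∈)
  taken? μ b | no none = no λ (_ , p∈) → none (lose p∈ refl)

  -- μ lists the pairs (pigeon , hole) placed so far; pigeons are placed in the order 1, 2, …
  record Placement (μ : List Var) (free : List ℕ) : Set where
    field
      pigeons-placed : ∀ {p} → p ∈ μ → 1 ≤ proj₁ p × proj₁ p ≤ length μ
      holes-in-range : ∀ {p} → p ∈ μ → proj₂ p ∈ range H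
      free-or-taken  : ∀ {b} → b ∈ range H → b ∈ free ⊎ Taken μ b
      free-in-range  : ∀ {b} → b ∈ free → b ∈ range H
      size           : length μ + length free ≤ H
  open Placement

  record Refutes (μ : List Var) (free : List ℕ) : Set where
    constructor refutes
    field
      tree        : RTree
      valid       : IsResTree tree
      leaves      : LeavesIn F tree
      root-placed : ∀ {l} → l ∈ label tree → Placed μ l
      hts≤        : hts tree ≤ 1 ⊔ length free
      whd≤        : whdT tree ≤ W

  length-root≤ : ∀ {μ T} → IsResTree T → (∀ {l} → l ∈ label T → Placed μ l) → length (label T) ≤ length μ
  length-root≤ {μ} {T} t placed =
    ≤-trans (Unique⇒length≤ _≟ₗ_ (proj₁ (root-isClause t)) root⊆) (≤-reflexive (length-map _ μ))
    where
    root⊆ : ∀ {l} → l ∈ label T → l ∈ map (λ p → neg (v (proj₁ p) (proj₂ p))) μ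
    root⊆ l∈ with placed l∈
    ... | p , p∈ , refl = ∈-map⁺ _ p∈

  forget : ∀ {μ free p b} (R : Refutes (p ∷ μ) (free ∖ b)) →
           neg (v (proj₁ p) (proj₂ p)) ∉ label (Refutes.tree R) → Refutes μ free
  forget {free = free} {b = b} (refutes T t leaves placed hts≤ whd≤) absent =
    refutes T t leaves placed′ (≤-trans hts≤ (⊔-monoʳ-≤ 1 (length-filter (λ b′ → ¬? (b′ ≟ b)) free))) whd≤
    where
    placed′ : ∀ {l} → l ∈ label T → Placed _ l
    placed′ l∈ with placed l∈
    ... | _ , here refl , refl = ⊥-elim (absent l∈)
    ... | q , there q∈ , l≡ = q , q∈ , l≡

  place : ∀ {μ free b} → Placement μ free → b ∈ free → Placement ((suc (length μ) , b) ∷ μ) (free ∖ b)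
  place {μ} {free} {b} inv b∈ = record
    { pigeons-placed = λ where
        (here refl) → s≤s z≤n , ≤-refl
        (there p∈)  → proj₁ (pigeons-placed inv p∈) , m≤n⇒m≤1+n (proj₂ (pigeons-placed inv p∈))
    ; holes-in-range = λ where
        (here refl) → free-in-range inv b∈
        (there p∈)  → holes-in-range inv p∈
    ; free-or-taken = free-or-taken′
    ; free-in-range = free-in-range inv ∘ proj₁ ∘ ∈-filter⁻ (λ b′ → ¬? (b′ ≟ b))
    ; size = ≤-trans (≤-reflexive (sym (+-suc (length μ) _)))
                     (≤-trans (+-monoʳ-≤ (length μ) (length-filter-≢ _≟_ b∈)) (size inv))
    }
    where
    free-or-taken′ : ∀ {b′} → b′ ∈ range H → b′ ∈ free ∖ b ⊎ Taken ((suc (length μ) , b) ∷ μ) b′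
    free-or-taken′ {b′} b′∈ with free-or-taken inv b′∈ | b′ ≟ b
    ... | inj₂ (a , taken) | _      = inj₂ (a , there taken)
    ... | inj₁ _           | yes refl = inj₂ (suc (length μ) , here refl)
    ... | inj₁ b′∈free     | no b′≢b  = inj₁ (∈-filter⁺ (λ b′ → ¬? (b′ ≟ b)) b′∈free b′≢b)

  module Stage {μ free} (inv : Placement μ free)
               (child : ∀ {b} → b ∈ free → Refutes ((suc (length μ) , b) ∷ μ) (free ∖ b)) where

    a : ℕ
    a = suc (length μ)

    a-unplaced : ∀ {p} → p ∈ μ → proj₁ p ≢ a
    a-unplaced p∈ eq = <-irrefl eq (s≤s (proj₂ (pigeons-placed inv p∈)))

    μ≤H : length μ ≤ H
    μ≤H = ≤-trans (m≤m+n (length μ) (length free)) (size inv)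

    a∈range : a ∈ range M
    a∈range = ∈-range⁺ (s≤s z≤n) (≤-trans (s≤s μ≤H) H<M)

    Side : Literal → Set
    Side l = Placed μ l ⊎ ∃[ b ] l ≡ pos (v a b)

    Side-consistent : ∀ l → Side l → ¬ Side (comp l)
    Side-consistent _ (inj₁ (_ , _ , refl)) (inj₁ (_ , _ , ()))
    Side-consistent _ (inj₁ (p , p∈ , refl)) (inj₂ (_ , eq)) = a-unplaced p∈ (proj₁ (v-injective (cong var eq)))
    Side-consistent _ (inj₂ (_ , refl)) (inj₁ (p , p∈ , eq)) = a-unplaced p∈ (sym (proj₁ (v-injective (cong var eq))))
    Side-consistent _ (inj₂ (_ , refl)) (inj₂ (_ , ()))

    -- A tree grown from the clause of pigeon a; Pos describes the holes b whose literal
    -- v a b may still occur in the root.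
    record Chain (Pos : ℕ → Set) (bound : ℕ) : Set where
      constructor chain
      field
        tree      : RTree
        valid     : IsResTree tree
        leaves    : LeavesIn F tree
        side      : ∀ {l} → l ∈ label tree → Side l
        positives : ∀ {b} → pos (v a b) ∈ label tree → Pos b
        hts≤      : hts tree ≤ bound
        whd≤      : whdT tree ≤ W
    open Chain using (tree)

    relax : ∀ {Pos Pos′ B B′} (S : Chain Pos B) → (∀ {b} → pos (v a b) ∈ label (tree S) → Pos b → Pos′ b) →
            B ≤ B′ → Chain Pos′ B′
    relax (chain S s leaves side positives hts≤ whd≤) weaken B≤B′ =
      chain S s leaves side (λ b∈ → weaken b∈ (positives b∈)) (≤-trans hts≤ B≤B′) whd≤

    resolve-hole : ∀ {Pos Pos′ B B′ b T} (S : Chain Pos B) → pos (v a b) ∈ label (tree S) →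
      IsResTree T → LeavesIn F T → neg (v a b) ∈ label T →
      (∀ {l} → l ∈ label T → l ≢ neg (v a b) → Placed μ l) → (∀ {b′} → Pos b′ → b′ ≢ b → Pos′ b′) →
      htsJoin (hts (tree S)) (hts T) ≤ B′ → whdT T ≤ W → length (label T) ≤ W → Chain Pos′ B′
    resolve-hole {Pos′ = Pos′} {b = b} {T} (chain S s leaves side positives _ whd≤)
                 present t leaves-T negated T-placed tail hts≤ whd-T≤ |T|≤W =
      chain (node R S T) (proj₁ step) (leaves , leaves-T) (proj₂ step)
            positives′ hts≤ (⊔-lub (⊔-lub whd≤ whd-T≤) (≤-trans (m⊓n≤n _ _) |T|≤W))
      where
      R : Clause
      R = resolvent (pos (v a b)) (label S) (label T)
      step : IsResTree (node R S T) × (∀ {l} → l ∈ R → Side l)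
      step = resolution-step Side Side-consistent (pos (v a b)) s t present negated
               (λ l∈ _ → side l∈) (λ l∈ l≢ → inj₁ (T-placed l∈ l≢))
      positives′ : ∀ {b′} → pos (v a b′) ∈ R → Pos′ b′
      positives′ l∈ with ∈-resolvent⁻ {C = label S} {label T} l∈
      ... | inj₁ (l∈S , l≢x) = tail (positives l∈S) λ { refl → l≢x refl }
      ... | inj₂ (l∈T , l≢x̄) with T-placed l∈T l≢x̄
      ...   | _ , _ , ()

    FreePos : List ℕ → ℕ → Set
    FreePos r b = b ∈ range H × (b ∈ r ⊎ Taken μ b)

    FreePos-tail : ∀ {b r b′} → FreePos (b ∷ r) b′ → b′ ≢ b → FreePos r b′
    FreePos-tail (_ , inj₁ (here refl)) b′≢b    = ⊥-elim (b′≢b refl)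
    FreePos-tail (b′∈ , inj₁ (there b′∈r)) _   = b′∈ , inj₁ b′∈r
    FreePos-tail (b′∈ , inj₂ taken) _          = b′∈ , inj₂ taken

    childHts : ℕ
    childHts = 1 ⊔ pred (length free)

    pigeon-leaf : Chain (FreePos free) (chainHts childHts 0)
    pigeon-leaf = chain (leaf Pₐ) (leaf Pₐ-isClause) (pigeon∈F a∈range) side positives z≤n z≤n
      where
      Pₐ : Clause
      Pₐ = map (λ b → pos (v a b)) (range H)
      pos-v-injective : ∀ {b b′} → pos (v a b) ≡ pos (v a b′) → b ≡ b′
      pos-v-injective eq = proj₂ (v-injective (cong var eq))
      Pₐ-isClause : IsClause Pₐ
      Pₐ-isClause = Unique.map⁺ pos-v-injective (range-unique H) ,
        λ l l∈ l̄∈ → case ∈-map⁻ _ l∈ , ∈-map⁻ _ l̄∈ of λ where ((_ , _ , refl) , (_ , _ , ()))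
      side : ∀ {l} → l ∈ Pₐ → Side l
      side l∈ with ∈-map⁻ _ l∈
      ... | b , _ , l≡ = inj₂ (b , l≡)
      positives : ∀ {b} → pos (v a b) ∈ Pₐ → FreePos free b
      positives l∈ with ∈-map⁻ _ l∈
      ... | b , b∈ , eq with pos-v-injective eq
      ...   | refl = b∈ , free-or-taken inv b∈

    child-hts≤ : ∀ {b} (b∈ : b ∈ free) → hts (Refutes.tree (child b∈)) ≤ childHts
    child-hts≤ b∈ = ≤-trans (Refutes.hts≤ (child b∈)) (⊔-monoʳ-≤ 1 (<⇒≤pred (length-filter-≢ _≟_ b∈)))

    1+μ≤H : ∀ {b} → b ∈ free → suc (length μ) ≤ H
    1+μ≤H b∈ = begin
      suc (length μ)          ≡⟨ +-comm 1 (length μ) ⟩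
      length μ + 1            ≤⟨ +-monoʳ-≤ (length μ) (≤-trans (s≤s z≤n) (length-filter-≢ _≟_ b∈)) ⟩
      length μ + length free  ≤⟨ size inv ⟩
      H                       ∎
      where open ≤-Reasoning

    child-length≤ : ∀ {b} (b∈ : b ∈ free) → length (label (Refutes.tree (child b∈))) ≤ W
    child-length≤ b∈ = ≤-trans (length-root≤ (Refutes.valid (child b∈)) (Refutes.root-placed (child b∈)))
                               (≤-trans (1+μ≤H b∈) (m≤m⊔n H 2))

    child-placed : ∀ {b} (b∈ : b ∈ free) {l} → l ∈ label (Refutes.tree (child b∈)) → l ≢ neg (v a b) → Placed μ l
    child-placed b∈ l∈ l≢ with Refutes.root-placed (child b∈) l∈
    ... | _ , here refl , refl = ⊥-elim (l≢ refl)
    ... | q , there q∈ , l≡    = q , q∈ , l≡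

    resolve-free-hole : ∀ {b r c} → b ∈ free → Chain (FreePos (b ∷ r)) (chainHts childHts c) →
                        Refutes μ free ⊎ Chain (FreePos r) (chainHts childHts (suc c))
    resolve-free-hole {b} {c = c} b∈ S with neg (v a b) ∈ₗ? label (Refutes.tree (child b∈))
    ... | no absent = inj₁ (forget (child b∈) absent)
    ... | yes negated with pos (v a b) ∈ₗ? label (tree S)
    ...   | no absent =
      inj₂ (relax S (λ b′∈ pos → FreePos-tail pos λ { refl → absent b′∈ }) (chainHts-mono childHts c))
    ...   | yes present =
      inj₂ (resolve-hole S present (Refutes.valid (child b∈)) (Refutes.leaves (child b∈)) negated (child-placed b∈)
              FreePos-tail (chainHts-step c (m≤m⊔n 1 (pred (length free))) (Chain.hts≤ S) (child-hts≤ b∈))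
              (Refutes.whd≤ (child b∈)) (child-length≤ b∈))

    resolve-free-holes : ∀ r c → r ⊆ free → c + length r ≡ length free → Chain (FreePos r) (chainHts childHts c) →
                         Refutes μ free ⊎ Chain (FreePos []) (chainHts childHts (length free))
    resolve-free-holes [] c _ c+0≡ S =
      inj₂ (relax S (λ _ pos → pos) (≤-reflexive (cong (chainHts childHts) (trans (sym (+-identityʳ c)) c+0≡))))
    resolve-free-holes (b ∷ r) c b∷r⊆free c+|b∷r|≡ S with resolve-free-hole (b∷r⊆free (here refl)) S
    ... | inj₁ done = inj₁ done
    ... | inj₂ S′   = resolve-free-holes r (suc c) (b∷r⊆free ∘ there) (trans (sym (+-suc c (length r))) c+|b∷r|≡) S′

    TakenPos : List ℕ → ℕ → Set
    TakenPos r b = Taken μ b × b ∈ r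

    TakenPos-tail : ∀ {b r b′} → TakenPos (b ∷ r) b′ → b′ ≢ b → TakenPos r b′
    TakenPos-tail (_ , here refl) b′≢b      = ⊥-elim (b′≢b refl)
    TakenPos-tail (taken , there b′∈r) _    = taken , b′∈r

    resolve-taken-holes : ∀ r → Chain (TakenPos r) (1 ⊔ length free) → Refutes μ free
    resolve-taken-holes [] (chain S s leaves side positives hts≤ whd≤) = refutes S s leaves placed hts≤ whd≤
      where
      placed : ∀ {l} → l ∈ label S → Placed μ l
      placed l∈ with side l∈
      ... | inj₁ l-placed = l-placed
      ... | inj₂ (_ , refl) with () ← proj₂ (positives l∈)
    resolve-taken-holes (b ∷ r) S with taken? μ b
    ... | no untaken = resolve-taken-holes r
            (relax S (λ _ pos → TakenPos-tail pos λ { refl → untaken (proj₁ pos) }) ≤-refl)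
    ... | yes (a′ , a′b∈μ) with pos (v a b) ∈ₗ? label (tree S)
    ...   | no absent = resolve-taken-holes r
              (relax S (λ b′∈ pos → TakenPos-tail pos λ { refl → absent b′∈ }) ≤-refl)
    ...   | yes present = resolve-taken-holes r
              (resolve-hole S present (leaf (negPair-isClause va≢va′)) collision (here refl) collision-placed
                 TakenPos-tail hts≤ z≤n (m≤n⊔m H 2))
      where
      a≢a′ : a ≢ a′
      a≢a′ = a-unplaced a′b∈μ ∘ sym
      va≢va′ : v a b ≢ v a′ b
      va≢va′ = a≢a′ ∘ proj₁ ∘ v-injective
      collision : LeavesIn F (leaf (neg (v a b) ∷ neg (v a′ b) ∷ []))
      collision = collision∈F a∈range (∈-range⁺ (proj₁ (pigeons-placed inv a′b∈μ))
                    (≤-trans (proj₂ (pigeons-placed inv a′b∈μ)) (≤-trans μ≤H (<⇒≤ H<M))))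
                    (holes-in-range inv a′b∈μ) a≢a′
      collision-placed : ∀ {l} → l ∈ neg (v a b) ∷ neg (v a′ b) ∷ [] → l ≢ neg (v a b) → Placed μ l
      collision-placed (here refl) l≢ = ⊥-elim (l≢ refl)
      collision-placed (there (here refl)) _ = (a′ , b) , a′b∈μ , refl
      hts≤ : htsJoin (hts (tree S)) 0 ≤ 1 ⊔ length free
      hts≤ = ≤-trans (htsJoin-zeroʳ-≤ (hts (tree S))) (⊔-lub (m≤m⊔n 1 (length free)) (Chain.hts≤ S))

    refutation : Refutes μ free
    refutation with resolve-free-holes free 0 (λ b∈ → b∈) refl pigeon-leaf
    ... | inj₁ done = done
    ... | inj₂ S    = resolve-taken-holes (range H) (relax S (λ _ → only-taken) (chainHts-end (length free)))
      where
      only-taken : ∀ {b} → FreePos [] b → TakenPos (range H) b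
      only-taken (b∈ , inj₂ taken) = taken , b∈

  build : ∀ f {μ free} → length free ≤ f → Placement μ free → Refutes μ free
  build zero {free = []} _ inv = Stage.refutation inv λ ()
  build (suc f) |free|≤1+f inv = Stage.refutation inv λ b∈ →
    build f (≤-pred (≤-trans (length-filter-≢ _≟_ b∈) |free|≤1+f)) (place inv b∈)

  empty-placement : Placement [] (range H)
  empty-placement = record
    { pigeons-placed = λ () ; holes-in-range = λ () ; free-or-taken = inj₁ ; free-in-range = λ b∈ → b∈
    ; size = ≤-reflexive (length-range H) }

  wide-refutation : ∃[ T ] IsRefutation F T × hts T ≤ 1 ⊔ H × whdT T ≤ H ⊔ 2
  wide-refutation with build H (≤-reflexive (length-range H)) empty-placement
  ... | refutes T t leaves placed hts≤ whd≤ =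
    T , (t , leaves , no-literals⇒≡[] (λ l∈ → case placed l∈ of λ ())) ,
    subst (λ x → hts T ≤ 1 ⊔ x) (length-range H) hts≤ , whd≤

-- With a single hole the general construction only reaches width 2.
one-hole-refutation : ∀ {F M} → ContainsPHP F M 1 → 1 < M → ∃[ T ] IsRefutation F T × hts T ≤ 1 × whdT T ≤ 1
one-hole-refutation {M = M} P 1<M =
  tree ,
  (proj₁ step₂ , (pigeon∈F 1∈ , pigeon∈F 2∈ , collision∈F 2∈ 1∈ (here refl) (λ ())) , no-literals⇒≡[] (proj₂ step₂)) ,
  ≤-refl , ⊔-lub ≤-refl (m⊓n≤m 1 (length R₁))
  where
  open ContainsPHP P
  1∈ : 1 ∈ range M
  1∈ = ∈-range⁺ ≤-refl (<⇒≤ 1<M)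
  2∈ : 2 ∈ range M
  2∈ = ∈-range⁺ (s≤s z≤n) 1<M
  v₂≢v₁ : v 2 1 ≢ v 1 1
  v₂≢v₁ = (λ ()) ∘ proj₁ ∘ v-injective
  N : Clause
  N = neg (v 2 1) ∷ neg (v 1 1) ∷ []
  R₁ : Clause
  R₁ = resolvent (pos (v 2 1)) (pos (v 2 1) ∷ []) N
  tree : RTree
  tree = node (resolvent (pos (v 1 1)) (pos (v 1 1) ∷ []) R₁)
              (leaf (pos (v 1 1) ∷ [])) (node R₁ (leaf (pos (v 2 1) ∷ [])) (leaf N))
  step₁ : IsResTree (node R₁ (leaf (pos (v 2 1) ∷ [])) (leaf N)) × (∀ {l} → l ∈ R₁ → l ≡ neg (v 1 1))
  step₁ = resolution-step (_≡ neg (v 1 1)) (λ { _ refl () }) (pos (v 2 1))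
            (leaf (unit-isClause _)) (leaf (negPair-isClause v₂≢v₁)) (here refl) (here refl)
            (λ { (here refl) l≢ → ⊥-elim (l≢ refl) })
            (λ { (here refl) l≢ → ⊥-elim (l≢ refl) ; (there (here refl)) _ → refl })
  step₂ : IsResTree tree × (∀ {l} → ¬ l ∈ label tree)
  step₂ = resolution-step (λ _ → ⊥) (λ _ ()) (pos (v 1 1)) (leaf (unit-isClause _)) (proj₁ step₁) (here refl)
            (∈-resolvent⁺ʳ {x = pos (v 2 1)} {C = pos (v 2 1) ∷ []} {D = N}
               (there (here refl)) (v₂≢v₁ ∘ sym ∘ cong var))
            (λ { (here refl) l≢ → l≢ refl }) (λ l∈ l≢ → l≢ (proj₂ step₁ l∈))

php-refutation : ∀ {F M H} → ContainsPHP F M H → H < M → ∃[ T ] IsRefutation F T × hts T ≤ H × whdT T ≤ H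
php-refutation {H = zero} P 0<M =
  leaf [] , (leaf ([]ᵃ , λ _ ()) , ContainsPHP.pigeon∈F P (∈-range⁺ ≤-refl 0<M) , refl) , z≤n , z≤n
php-refutation {H = suc zero} P 1<M = one-hole-refutation P 1<M
php-refutation {H = suc (suc _)} P H<M with PHPRefutation.wide-refutation P H<M
... | T , refutation , hts≤ , whd≤ = T , refutation , hts≤ , ≤-trans whd≤ (⊔-lub ≤-refl (s≤s (s≤s z≤n)))

OFPHP-contains-PHP : ∀ m k → ContainsPHP (OFPHP m k) m k
OFPHP-contains-PHP m k = record
  { v = _,_ ; v-injective = λ { refl → refl , refl }
  ; pigeon∈F = pigeonClause∈F
  ; collision∈F = λ a∈ a′∈ b∈ a≢a′ → sharedHole∈F b∈ a∈ a′∈ a≢a′ }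

-- The holes of OFPHP m k are also pigeons that must each sit in one of the m pigeons.
OFPHP-contains-dual-PHP : ∀ m k → ContainsPHP (OFPHP m k) k m
OFPHP-contains-dual-PHP m k = record
  { v = λ a b → b , a ; v-injective = λ { refl → refl , refl }
  ; pigeon∈F = holeClause∈F
  ; collision∈F = λ a∈ a′∈ b∈ a≢a′ → sharedPigeon∈F b∈ a∈ a′∈ a≢a′ }

upper-bound : ∀ m k → m ≢ k → ∃[ T ] IsRefutation (OFPHP m k) T × hts T ≤ m ⊓ k × whdT T ≤ m ⊓ k
upper-bound m k m≢k with <-cmp m k
... | tri< m<k _ _ = subst (λ x → ∃[ T ] IsRefutation (OFPHP m k) T × hts T ≤ x × whdT T ≤ x)
                       (sym (m≤n⇒m⊓n≡m (<⇒≤ m<k))) (php-refutation (OFPHP-contains-dual-PHP m k) m<k)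
... | tri≈ _ m≡k _ = ⊥-elim (m≢k m≡k)
... | tri> _ _ k<m = subst (λ x → ∃[ T ] IsRefutation (OFPHP m k) T × hts T ≤ x × whdT T ≤ x)
                       (sym (m≥n⇒m⊓n≡n (<⇒≤ k<m))) (php-refutation (OFPHP-contains-PHP m k) k<m)

corollary8p5 : (m k : ℕ) → m ≢ k →
    whdIs (OFPHP m k) (m ⊓ k) × hdIs (OFPHP m k) (m ⊓ k)
corollary8p5 m k m≢k with upper-bound m k m≢k
... | T , refutation , hts≤ , whd≤ =
  ((T , refutation , ≤-antisym whd≤ (whd-lower-bound T refutation)) , whd-lower-bound) ,
  ((T , refutation , ≤-antisym hts≤ (hd-lower-bound T refutation)) , hd-lower-bound)
  where open Adversary m k
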